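{- Let $\epsilon>0$ and let $H$ be a $3$-graph on $n$ vertices. Then there exists a subhypergraph $H_\epsilon$ of $H$ such that (i) $|V(H)\setminus V(H_\epsilon)|\le 3\epsilon n$; (ii) $\deg_{H_\epsilon}(v)\ge \deg_H(v)-7\epsilon\binom n2$ for every $v\in V(H_\epsilon)$; (iii) $\deg_H(S)>\epsilon^2 n$ for every pair $S\in\partial H_\epsilon$.
   Context: For a $3$-graph $H$ and a set $S$ of one or two vertices, $\deg_H(S)$ is the number of edges of $H$ containing $S$ (for a vertex $v$, $\deg_H(v)=\deg_H(\{v\})$). The shadow $\partial G$ of a $3$-graph $G$ is the set of pairs of vertices contained in at least one edge of $G$.
   Formalization: The parameter ε ranges over the positive rationals. -}

module Defs where

open import Data.Nat using (ℕ; _<_; _<ᵇ_)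
open import Data.Nat.Combinatorics using (_C_)
open import Data.Fin using (Fin; toℕ; _≟_)
open import Data.Fin.Base using ()
open import Data.List using (List; []; _∷_; length; filter; concatMap; allFin)
open import Data.Bool using (Bool; true; false; _∧_; _∨_; not; T)
open import Data.Product using (_×_; _,_; Σ; ∃)
open import Data.Integer using (+_)
open import Data.Rational using (ℚ; _/_)
open import Relation.Nullary.Decidable using (⌊_⌋; T?)
open import Relation.Binary.PropositionalEquality using (_≡_)

ℕ→ℚ : ℕ → ℚ
ℕ→ℚ m = + m / 1

-- A triple of vertices; a 3-element vertex set {i,j,k} is represented by
-- the unique triple (i , j , k) with i < j < k.
Triple : ℕ → Set
Triple n = Fin n × Fin n × Fin n

Increasing : ∀ {n} → Triple n → Set
Increasing (i , j , k) = toℕ i < toℕ j × toℕ j < toℕ k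

increasingᵇ : ∀ {n} → Triple n → Bool
increasingᵇ (i , j , k) = (toℕ i <ᵇ toℕ j) ∧ (toℕ j <ᵇ toℕ k)

triples : (n : ℕ) → List (Triple n)
triples n = filter (λ t → T? (increasingᵇ t))
  (concatMap (λ i → concatMap (λ j → Data.List.map (λ k → (i , j , k)) (allFin n)) (allFin n)) (allFin n))

-- A 3-graph on vertex set Fin n: the edge {i,j,k} (i<j<k) is present iff
-- the indicator returns true on (i , j , k); values on non-increasing
-- triples are irrelevant.
3Graph : ℕ → Set
3Graph n = Triple n → Bool

_∈ᵗ_ : ∀ {n} → Fin n → Triple n → Bool
v ∈ᵗ (i , j , k) = ⌊ v ≟ i ⌋ ∨ ⌊ v ≟ j ⌋ ∨ ⌊ v ≟ k ⌋

deg : ∀ {n} → 3Graph n → Fin n → ℕ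
deg {n} H v = length (filter (λ t → T? (H t ∧ (v ∈ᵗ t))) (triples n))

deg₂ : ∀ {n} → 3Graph n → Fin n → Fin n → ℕ
deg₂ {n} H u w = length (filter (λ t → T? (H t ∧ (u ∈ᵗ t) ∧ (w ∈ᵗ t))) (triples n))

record SubHypergraph {n : ℕ} (H : 3Graph n) : Set where
  field
    W : Fin n → Bool
    E : 3Graph n
    sub : ∀ (t : Triple n) → Increasing t → T (E t) → T (H t)
    inW : ∀ (t : Triple n) → Increasing t → T (E t) →
          ∀ (v : Fin n) → T (v ∈ᵗ t) → T (W v)

InShadow : ∀ {n} → 3Graph n → Fin n → Fin n → Set
InShadow {n} E u w =
  Σ (Triple n) λ t → Increasing t × T (E t) × T (u ∈ᵗ t) × T (w ∈ᵗ t)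

missing : ∀ {n} → (Fin n → Bool) → ℕ
missing {n} W = length (filter (λ v → T? (not (W v))) (allFin n))

-- Call a pair light if its codegree in H is at most ε²n, and a vertex bad if more than ε·C(n,2) of
-- its edges contain a light pair. H_ε keeps the good vertices and those edges of H whose three pairs
-- are heavy and whose vertices are good, so (iii) holds by construction. An edge containing a light
-- pair is lost at no more than three vertices and is charged to one of its light pairs, so the total
-- loss is at most 3·C(n,2)·ε²n and, by Markov's inequality, at most 3εn vertices are bad. A good
-- vertex loses at most ε·C(n,2) edges through light pairs and at most n − 1 edges through each bad
-- vertex, in total at most εC(n,2) + 3εn(n − 1) = 7εC(n,2).
module Submission where

open import Defs

module Cleaning where

  open import Data.Nat as ℕ using (ℕ; zero; suc; _+_; _*_; _∸_; z≤n; s≤s; _<ᵇ_)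
  import Data.Nat.Properties as ℕ
  open import Data.Nat.Properties using (<ᵇ⇒<; <⇒<ᵇ)
  open import Data.Nat.Combinatorics using (_C_; nC1≡n; nCk+nC[k+1]≡[n+1]C[k+1])
  open import Data.Nat.Solver using (module +-*-Solver)
  open import Data.Fin.Properties using (toℕ-injective)
  open import Data.Fin using (Fin; zero; suc; toℕ; _≟_)
  open import Data.List using (List; []; _∷_; _++_; length; filter; concatMap; map; allFin; tabulate)
  open import Data.Bool using (Bool; true; false; _∧_; _∨_; not; T)
  open import Data.Product using (_×_; _,_; proj₁; proj₂)
  open import Data.Sum as Sum using (_⊎_; inj₁; inj₂)
  open import Data.Integer as ℤ using (1ℤ)
  import Data.Integer.Properties as ℤ
  open import Data.Rational as ℚ using (ℚ; mkℚ; 0ℚ; 1ℚ)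
  import Data.Rational.Properties as ℚ
  open import Data.Rational.Solver using () renaming (module +-*-Solver to ℚ-Solver)
  import Data.Rational.Unnormalised as ℚᵘ
  import Data.Rational.Unnormalised.Properties as ℚᵘ
  import Data.Nat.Coprimality as Coprime
  open import Function using (_∘_; id; Equivalence)
  open import Data.Bool.Properties using (T-≡; T-∧; T-∨; not-involutive)
  open import Relation.Nullary using (¬_; yes; no; contradiction)
  open import Relation.Binary using (tri<; tri≈; tri>)
  open import Relation.Nullary.Decidable using (⌊_⌋; T?; toWitness; fromWitness; toWitnessFalse)
  open import Relation.Binary.PropositionalEquality
    using (_≡_; _≢_; refl; sym; trans; cong; cong₂; subst; subst₂; module ≡-Reasoning)
  open import Algebra.Properties.CommutativeSemigroup ℕ.+-commutativeSemigroup
    using () renaming (interchange to +-interchange)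
  open import Algebra.Properties.CommutativeSemigroup ℕ.*-commutativeSemigroup
    using () renaming (x∙yz≈y∙xz to *-left-comm; x∙yz≈y∙zx to *-rotate)

  -- Iverson brackets and finite sums

  ⟦_⟧ : Bool → ℕ
  ⟦ true ⟧ = 1
  ⟦ false ⟧ = 0

  ⟦⟧≤1 : ∀ b → ⟦ b ⟧ ℕ.≤ 1
  ⟦⟧≤1 true = s≤s z≤n
  ⟦⟧≤1 false = z≤n

  ⟦⟧-true : ∀ {b} → T b → ⟦ b ⟧ ≡ 1
  ⟦⟧-true {true} _ = refl

  ⟦⟧-split : ∀ h m g a → ⟦ h ∧ m ⟧ ℕ.≤ ⟦ (h ∧ g ∧ a) ∧ m ⟧ + ⟦ h ∧ m ∧ not g ⟧ + ⟦ m ⟧ * ⟦ not a ⟧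
  ⟦⟧-split false m g a = z≤n
  ⟦⟧-split true false g a = z≤n
  ⟦⟧-split true true false a = s≤s z≤n
  ⟦⟧-split true true true false = s≤s z≤n
  ⟦⟧-split true true true true = s≤s z≤n

  T-∧³ : ∀ {a b c} → T (a ∧ b ∧ c) → T a × T b × T c
  T-∧³ {true} {true} {true} _ = _ , _ , _

  ⟦⟧-≤ : ∀ {b m} → (T b → 1 ℕ.≤ m) → ⟦ b ⟧ ℕ.≤ m
  ⟦⟧-≤ {false} _ = z≤n
  ⟦⟧-≤ {true} 1≤m = 1≤m _

  ⟦∧⟧ : ∀ a b → ⟦ a ∧ b ⟧ ≡ ⟦ a ⟧ * ⟦ b ⟧
  ⟦∧⟧ true b = sym (ℕ.+-identityʳ ⟦ b ⟧)
  ⟦∧⟧ false b = refl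

  ⟦∨⟧≤ : ∀ a b → ⟦ a ∨ b ⟧ ℕ.≤ ⟦ a ⟧ + ⟦ b ⟧
  ⟦∨⟧≤ true b = s≤s z≤n
  ⟦∨⟧≤ false b = ℕ.≤-refl

  ⟦⟧-false : ∀ {b} → ¬ T b → ⟦ b ⟧ ≡ 0
  ⟦⟧-false {true} ¬b = contradiction _ ¬b
  ⟦⟧-false {false} _ = refl

  ⟦⟧-exclusive : ∀ {a b c} → (T a → ¬ T b) → (T a → ¬ T c) → (T b → ¬ T c) → ⟦ a ⟧ + ⟦ b ⟧ + ⟦ c ⟧ ℕ.≤ 1
  ⟦⟧-exclusive {true} {true} a⇒¬b _ _ = contradiction _ (a⇒¬b _)
  ⟦⟧-exclusive {true} {false} {true} _ a⇒¬c _ = contradiction _ (a⇒¬c _)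
  ⟦⟧-exclusive {true} {false} {false} _ _ _ = s≤s z≤n
  ⟦⟧-exclusive {false} {true} {true} _ _ b⇒¬c = contradiction _ (b⇒¬c _)
  ⟦⟧-exclusive {false} {true} {false} _ _ _ = s≤s z≤n
  ⟦⟧-exclusive {false} {false} {c} _ _ _ = ⟦⟧≤1 c

  ⟦∧∧⟧ : ∀ a m b → ⟦ a ∧ m ∧ b ⟧ ≡ ⟦ a ∧ b ⟧ * ⟦ m ⟧
  ⟦∧∧⟧ false m b = refl
  ⟦∧∧⟧ true true b = sym (ℕ.*-identityʳ ⟦ b ⟧)
  ⟦∧∧⟧ true false b = sym (ℕ.*-zeroʳ ⟦ b ⟧)

  ⟦⟧*≤ : ∀ b m → ⟦ b ⟧ * m ℕ.≤ m
  ⟦⟧*≤ false m = z≤n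
  ⟦⟧*≤ true m = ℕ.≤-reflexive (ℕ.+-identityʳ m)

  ⟦⟧*-mono : ∀ b {x y} → (T b → x ℕ.≤ y) → ⟦ b ⟧ * x ℕ.≤ ⟦ b ⟧ * y
  ⟦⟧*-mono false _ = z≤n
  ⟦⟧*-mono true x≤y = ℕ.+-monoˡ-≤ 0 (x≤y _)

  ∑ : ∀ n → (Fin n → ℕ) → ℕ
  ∑ zero f = 0
  ∑ (suc n) f = f zero + ∑ n (f ∘ suc)

  infix 5 ∑
  syntax ∑ n (λ i → e) = ∑[ i < n ] e

  ∑-cong : ∀ n {f g : Fin n → ℕ} → (∀ i → f i ≡ g i) → ∑ n f ≡ ∑ n g
  ∑-cong zero f≗g = refl
  ∑-cong (suc n) f≗g = cong₂ _+_ (f≗g zero) (∑-cong n (f≗g ∘ suc))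

  ∑-mono-≤ : ∀ n {f g : Fin n → ℕ} → (∀ i → f i ℕ.≤ g i) → ∑ n f ℕ.≤ ∑ n g
  ∑-mono-≤ zero f≤g = z≤n
  ∑-mono-≤ (suc n) f≤g = ℕ.+-mono-≤ (f≤g zero) (∑-mono-≤ n (f≤g ∘ suc))

  ∑-≤-const : ∀ n {f : Fin n → ℕ} c → (∀ i → f i ℕ.≤ c) → ∑ n f ℕ.≤ n * c
  ∑-≤-const zero c f≤c = z≤n
  ∑-≤-const (suc n) c f≤c = ℕ.+-mono-≤ (f≤c zero) (∑-≤-const n c (f≤c ∘ suc))

  term≤∑ : ∀ n (f : Fin n → ℕ) i → f i ℕ.≤ ∑ n f
  term≤∑ (suc n) f zero = ℕ.m≤m+n _ _
  term≤∑ (suc n) f (suc i) = ℕ.≤-trans (term≤∑ n (f ∘ suc) i) (ℕ.m≤n+m _ (f zero))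

  pair-term≤ : ∀ {n} (F : Fin n → Fin n → ℕ) u w → F u w ℕ.≤ ∑[ u < n ] ∑[ w < n ] F u w
  pair-term≤ {n} F u w = ℕ.≤-trans (term≤∑ n (F u) w) (term≤∑ n (λ u → ∑ n (F u)) u)

  ∑-zero : ∀ n → ∑[ i < n ] 0 ≡ 0
  ∑-zero zero = refl
  ∑-zero (suc n) = ∑-zero n

  ∑-distrib-+ : ∀ n (f g : Fin n → ℕ) → ∑[ i < n ] (f i + g i) ≡ ∑ n f + ∑ n g
  ∑-distrib-+ zero f g = refl
  ∑-distrib-+ (suc n) f g = trans (cong (f zero + g zero +_) (∑-distrib-+ n (f ∘ suc) (g ∘ suc)))
    (+-interchange (f zero) (g zero) _ _)

  ∑-*ˡ : ∀ n c (f : Fin n → ℕ) → ∑[ i < n ] (c * f i) ≡ c * ∑ n f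
  ∑-*ˡ zero c f = sym (ℕ.*-zeroʳ c)
  ∑-*ˡ (suc n) c f = trans (cong (c * f zero +_) (∑-*ˡ n c (f ∘ suc))) (sym (ℕ.*-distribˡ-+ c _ _))

  ∑-comm : ∀ m n (f : Fin m → Fin n → ℕ) → ∑[ i < m ] ∑[ j < n ] f i j ≡ ∑[ j < n ] ∑[ i < m ] f i j
  ∑-comm zero n f = sym (∑-zero n)
  ∑-comm (suc m) n f = trans (cong (∑ n (f zero) +_) (∑-comm m n (f ∘ suc))) (sym (∑-distrib-+ n (f zero) _))

  ∑-≤-pred : ∀ n {g : Fin n → ℕ} v → g v ≡ 0 → (∀ x → g x ℕ.≤ 1) → ∑ n g ℕ.≤ n ∸ 1
  ∑-≤-pred (suc n) {g} zero g0≡0 g≤1 = begin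
    g zero + ∑ n (g ∘ suc) ≡⟨ cong (_+ ∑ n (g ∘ suc)) g0≡0 ⟩
    ∑ n (g ∘ suc)          ≤⟨ ∑-≤-const n 1 (g≤1 ∘ suc) ⟩
    n * 1                  ≡⟨ ℕ.*-identityʳ n ⟩
    n                      ∎
    where open ℕ.≤-Reasoning
  ∑-≤-pred (suc (suc n)) (suc v) gv≡0 g≤1 = ℕ.+-mono-≤ (g≤1 zero) (∑-≤-pred (suc n) v gv≡0 (g≤1 ∘ suc))

  ⌊suc≟suc⌋ : ∀ {n} (a b : Fin n) → ⌊ suc a ≟ suc b ⌋ ≡ ⌊ a ≟ b ⌋
  ⌊suc≟suc⌋ a b with a ≟ b
  ... | yes _ = refl
  ... | no _ = refl

  ∑-pick : ∀ {n} (a : Fin n) (f : Fin n → ℕ) → ∑[ x < n ] ⟦ ⌊ a ≟ x ⌋ ⟧ * f x ≡ f a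
  ∑-pick {suc n} zero f = trans (cong₂ _+_ (ℕ.+-identityʳ (f zero)) (∑-zero n)) (ℕ.+-identityʳ (f zero))
  ∑-pick {suc n} (suc a) f =
    trans (∑-cong n λ x → cong (λ b → ⟦ b ⟧ * f (suc x)) (⌊suc≟suc⌋ a x)) (∑-pick a (f ∘ suc))

  ∑-count-≡ : ∀ {n} (a : Fin n) → ∑[ x < n ] ⟦ ⌊ x ≟ a ⌋ ⟧ ≡ 1
  ∑-count-≡ {suc n} zero = cong suc (∑-zero n)
  ∑-count-≡ {suc n} (suc a) = trans (∑-cong n λ x → cong ⟦_⟧ (⌊suc≟suc⌋ x a)) (∑-count-≡ a)

  private variable
    A B : Set

  ∑ˡ : List A → (A → ℕ) → ℕ
  ∑ˡ [] f = 0
  ∑ˡ (x ∷ xs) f = f x + ∑ˡ xs f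

  length-filter : (p : A → Bool) (xs : List A) → length (filter (λ x → T? (p x)) xs) ≡ ∑ˡ xs (⟦_⟧ ∘ p)
  length-filter p [] = refl
  length-filter p (x ∷ xs) with p x
  ... | true = cong suc (length-filter p xs)
  ... | false = length-filter p xs

  ∑ˡ-filter : (p : A → Bool) (xs : List A) (f : A → ℕ) →
    ∑ˡ (filter (λ x → T? (p x)) xs) f ≡ ∑ˡ xs (λ x → ⟦ p x ⟧ * f x)
  ∑ˡ-filter p [] f = refl
  ∑ˡ-filter p (x ∷ xs) f with p x
  ... | true = cong₂ _+_ (sym (ℕ.+-identityʳ (f x))) (∑ˡ-filter p xs f)
  ... | false = ∑ˡ-filter p xs f

  ∑ˡ-++ : (xs ys : List A) (f : A → ℕ) → ∑ˡ (xs ++ ys) f ≡ ∑ˡ xs f + ∑ˡ ys f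
  ∑ˡ-++ [] ys f = refl
  ∑ˡ-++ (x ∷ xs) ys f = trans (cong (f x +_) (∑ˡ-++ xs ys f)) (sym (ℕ.+-assoc (f x) _ _))

  ∑ˡ-concatMap : (g : A → List B) (xs : List A) (f : B → ℕ) →
    ∑ˡ (concatMap g xs) f ≡ ∑ˡ xs (λ x → ∑ˡ (g x) f)
  ∑ˡ-concatMap g [] f = refl
  ∑ˡ-concatMap g (x ∷ xs) f = trans (∑ˡ-++ (g x) _ f) (cong (∑ˡ (g x) f +_) (∑ˡ-concatMap g xs f))

  ∑ˡ-map : (g : A → B) (xs : List A) (f : B → ℕ) → ∑ˡ (map g xs) f ≡ ∑ˡ xs (f ∘ g)
  ∑ˡ-map g [] f = refl
  ∑ˡ-map g (x ∷ xs) f = cong (f (g x) +_) (∑ˡ-map g xs f)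

  ∑ˡ-tabulate : ∀ n (g : Fin n → A) (f : A → ℕ) → ∑ˡ (tabulate g) f ≡ ∑ n (f ∘ g)
  ∑ˡ-tabulate zero g f = refl
  ∑ˡ-tabulate (suc n) g f = cong (f (g zero) +_) (∑ˡ-tabulate n (g ∘ suc) f)

  ∑ˡ-allFin : ∀ n (f : Fin n → ℕ) → ∑ˡ (allFin n) f ≡ ∑ n f
  ∑ˡ-allFin n = ∑ˡ-tabulate n id

  ∑ᵗ : ∀ {n} → (Triple n → ℕ) → ℕ
  ∑ᵗ {n} f = ∑[ i < n ] ∑[ j < n ] ∑[ k < n ] ⟦ increasingᵇ (i , j , k) ⟧ * f (i , j , k)

  module _ {n : ℕ} where

    ∑ᵗ-cong : {f g : Triple n → ℕ} → (∀ t → f t ≡ g t) → ∑ᵗ f ≡ ∑ᵗ g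
    ∑ᵗ-cong f≗g = ∑-cong n λ i → ∑-cong n λ j → ∑-cong n λ k →
      cong (⟦ increasingᵇ (i , j , k) ⟧ *_) (f≗g (i , j , k))

    ∑ᵗ-distrib-+ : (f g : Triple n → ℕ) → ∑ᵗ (λ t → f t + g t) ≡ ∑ᵗ f + ∑ᵗ g
    ∑ᵗ-distrib-+ f g =
      trans (∑-cong n λ i → trans (∑-cong n λ j →
        trans (∑-cong n λ k → ℕ.*-distribˡ-+ ⟦ increasingᵇ (i , j , k) ⟧ _ _) (∑-distrib-+ n _ _))
          (∑-distrib-+ n _ _))
        (∑-distrib-+ n _ _)

    ∑ᵗ-comm : ∀ {m} (g : Fin m → Triple n → ℕ) → ∑ᵗ (λ t → ∑[ u < m ] g u t) ≡ ∑[ u < m ] ∑ᵗ (g u)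
    ∑ᵗ-comm {m} g =
      trans (∑-cong n λ i → trans (∑-cong n λ j →
        trans (∑-cong n λ k → sym (∑-*ˡ m ⟦ increasingᵇ (i , j , k) ⟧ _)) (∑-comm n m _))
          (∑-comm n m _))
        (∑-comm n m _)

    ∑ᵗ-*ˡ : ∀ c (f : Triple n → ℕ) → ∑ᵗ (λ t → c * f t) ≡ c * ∑ᵗ f
    ∑ᵗ-*ˡ c f =
      trans (∑-cong n λ i → trans (∑-cong n λ j →
        trans (∑-cong n λ k → *-left-comm ⟦ increasingᵇ (i , j , k) ⟧ c (f (i , j , k))) (∑-*ˡ n c _))
          (∑-*ˡ n c _))
        (∑-*ˡ n c _)

  count-triples : ∀ n (p : Triple n → Bool) →
    length (filter (λ t → T? (p t)) (triples n)) ≡ ∑ᵗ (λ t → ⟦ p t ⟧)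
  count-triples n p = begin
    length (filter (λ t → T? (p t)) (triples n))
      ≡⟨ length-filter p (triples n) ⟩
    ∑ˡ (triples n) (⟦_⟧ ∘ p)
      ≡⟨ ∑ˡ-filter increasingᵇ candidates (⟦_⟧ ∘ p) ⟩
    ∑ˡ candidates f
      ≡⟨ ∑ˡ-concatMap (λ i → concatMap (row i) (allFin n)) (allFin n) f ⟩
    ∑ˡ (allFin n) (λ i → ∑ˡ (concatMap (row i) (allFin n)) f)
      ≡⟨ ∑ˡ-allFin n _ ⟩
    ∑[ i < n ] ∑ˡ (concatMap (row i) (allFin n)) f
      ≡⟨ ∑-cong n (λ i → trans (∑ˡ-concatMap (row i) (allFin n) f) (∑ˡ-allFin n _)) ⟩
    ∑[ i < n ] ∑[ j < n ] ∑ˡ (row i j) f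
      ≡⟨ ∑-cong n (λ i → ∑-cong n λ j →
           trans (∑ˡ-map (λ k → (i , j , k)) (allFin n) f) (∑ˡ-allFin n _)) ⟩
    ∑ᵗ (λ t → ⟦ p t ⟧) ∎
    where
    open ≡-Reasoning
    row : Fin n → Fin n → List (Triple n)
    row i j = map (λ k → (i , j , k)) (allFin n)
    candidates : List (Triple n)
    candidates = concatMap (λ i → concatMap (row i) (allFin n)) (allFin n)
    f : Triple n → ℕ
    f t = ⟦ increasingᵇ t ⟧ * ⟦ p t ⟧

  increasingᵇ⇒Increasing : ∀ {n} (t : Triple n) → T (increasingᵇ t) → Increasing t
  increasingᵇ⇒Increasing (i , j , k) inc with Equivalence.to T-∧ inc
  ... | i<j , j<k = <ᵇ⇒< (toℕ i) (toℕ j) i<j , <ᵇ⇒< (toℕ j) (toℕ k) j<k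

  ∑ᵗ-mono-≤ : ∀ {n} {f g : Triple n → ℕ} → (∀ t → Increasing t → f t ℕ.≤ g t) → ∑ᵗ f ℕ.≤ ∑ᵗ g
  ∑ᵗ-mono-≤ {n} f≤g = ∑-mono-≤ n λ i → ∑-mono-≤ n λ j → ∑-mono-≤ n λ k →
    ⟦⟧*-mono (increasingᵇ (i , j , k)) (f≤g (i , j , k) ∘ increasingᵇ⇒Increasing (i , j , k))

  ⟦increasing⟧-≡0 : ∀ {n} (t : Triple n) → ¬ Increasing t → ⟦ increasingᵇ t ⟧ ≡ 0
  ⟦increasing⟧-≡0 t ¬inc = ⟦⟧-false (¬inc ∘ increasingᵇ⇒Increasing t)

  ∈ᵗ-cases : ∀ {n} (v i j k : Fin n) → T (v ∈ᵗ (i , j , k)) → v ≡ i ⊎ v ≡ j ⊎ v ≡ k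
  ∈ᵗ-cases v i j k =
    Sum.map (toWitness {a? = v ≟ i})
      (Sum.map (toWitness {a? = v ≟ j}) (toWitness {a? = v ≟ k}) ∘ Equivalence.to T-∨)
    ∘ Equivalence.to T-∨

  ∈ᵗ-intro : ∀ {n} (v i j k : Fin n) → v ≡ i ⊎ v ≡ j ⊎ v ≡ k → T (v ∈ᵗ (i , j , k))
  ∈ᵗ-intro v i j k =
    Equivalence.from T-∨ ∘
    Sum.map (fromWitness {a? = v ≟ i})
      (Equivalence.from T-∨ ∘ Sum.map (fromWitness {a? = v ≟ j}) (fromWitness {a? = v ≟ k}))

  ∈ᵗ-first : ∀ {n} (i j k : Fin n) → T (i ∈ᵗ (i , j , k))
  ∈ᵗ-first i j k = ∈ᵗ-intro i i j k (inj₁ refl)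

  ∈ᵗ-second : ∀ {n} (i j k : Fin n) → T (j ∈ᵗ (i , j , k))
  ∈ᵗ-second i j k = ∈ᵗ-intro j i j k (inj₂ (inj₁ refl))

  ∈ᵗ-third : ∀ {n} (i j k : Fin n) → T (k ∈ᵗ (i , j , k))
  ∈ᵗ-third i j k = ∈ᵗ-intro k i j k (inj₂ (inj₂ refl))

  ⟦∈ᵗ⟧≤ : ∀ {n} (v i j k : Fin n) → ⟦ v ∈ᵗ (i , j , k) ⟧ ℕ.≤ ⟦ ⌊ v ≟ i ⌋ ⟧ + (⟦ ⌊ v ≟ j ⌋ ⟧ + ⟦ ⌊ v ≟ k ⌋ ⟧)
  ⟦∈ᵗ⟧≤ v i j k = ℕ.≤-trans (⟦∨⟧≤ ⌊ v ≟ i ⌋ _) (ℕ.+-monoʳ-≤ ⟦ ⌊ v ≟ i ⌋ ⟧ (⟦∨⟧≤ ⌊ v ≟ j ⌋ _))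

  ∑-∈ᵗ≤3 : ∀ {n} (t : Triple n) → ∑[ v < n ] ⟦ v ∈ᵗ t ⟧ ℕ.≤ 3
  ∑-∈ᵗ≤3 {n} (i , j , k) = begin
    ∑[ v < n ] ⟦ v ∈ᵗ (i , j , k) ⟧
      ≤⟨ ∑-mono-≤ n (λ v → ⟦∈ᵗ⟧≤ v i j k) ⟩
    ∑[ v < n ] ⟦ ⌊ v ≟ i ⌋ ⟧ + (⟦ ⌊ v ≟ j ⌋ ⟧ + ⟦ ⌊ v ≟ k ⌋ ⟧)
      ≡⟨ trans (∑-distrib-+ n _ _) (cong₂ _+_ (∑-count-≡ i) (trans (∑-distrib-+ n _ _)
           (cong₂ _+_ (∑-count-≡ j) (∑-count-≡ k)))) ⟩
    3 ∎
    where open ℕ.≤-Reasoning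

  -- A 3-set containing u < v has them in positions (1,2), (1,3) or (2,3) of its increasing triple,
  -- with some x in the remaining position; for each x at most one of these orderings is increasing,
  -- and none when x = v.
  module _ {n : ℕ} where

    private
      δ : Fin n → Fin n → ℕ
      δ a x = ⟦ ⌊ a ≟ x ⌋ ⟧

      inc : Fin n → Fin n → Fin n → ℕ
      inc i j k = ⟦ increasingᵇ (i , j , k) ⟧

    ∑ᵗ-at₁₂ : ∀ a b → ∑ᵗ (λ (i , j , k) → δ a i * δ b j) ≡ ∑[ x < n ] inc a b x
    ∑ᵗ-at₁₂ a b =
      trans (∑-cong n λ i → trans (∑-cong n λ j →
        trans (∑-cong n λ k → *-rotate (inc i j k) (δ a i) (δ b j)) (∑-*ˡ n (δ a i) _))
          (∑-*ˡ n (δ a i) _))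
        (trans (∑-pick a _) (trans (∑-cong n λ j → ∑-*ˡ n (δ b j) _) (∑-pick b _)))

    ∑ᵗ-at₁₃ : ∀ a b → ∑ᵗ (λ (i , j , k) → δ a i * δ b k) ≡ ∑[ x < n ] inc a x b
    ∑ᵗ-at₁₃ a b =
      trans (∑-cong n λ i → trans (∑-cong n λ j →
        trans (∑-cong n λ k → *-rotate (inc i j k) (δ a i) (δ b k)) (∑-*ˡ n (δ a i) _))
          (∑-*ˡ n (δ a i) _))
        (trans (∑-pick a _) (∑-cong n λ j → ∑-pick b _))

    ∑ᵗ-at₂₃ : ∀ a b → ∑ᵗ (λ (i , j , k) → δ a j * δ b k) ≡ ∑[ x < n ] inc x a b
    ∑ᵗ-at₂₃ a b = ∑-cong n λ i →
      trans (∑-cong n λ j → trans (∑-cong n λ k → *-rotate (inc i j k) (δ a j) (δ b k)) (∑-*ˡ n (δ a j) _))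
        (trans (∑-pick a _) (∑-pick b _))

    private
      δ*δ≡1 : ∀ {a b x y} → a ≡ x → b ≡ y → δ a x * δ b y ≡ 1
      δ*δ≡1 {a} {b} {x} {y} a≡x b≡y =
        cong₂ _*_ (⟦⟧-true (fromWitness {a? = a ≟ x} a≡x)) (⟦⟧-true (fromWitness {a? = b ≟ y} b≡y))

    ⟦∈ᵗ⟧*⟦∈ᵗ⟧≤ : ∀ {u v} → toℕ u ℕ.< toℕ v → ∀ i j k → Increasing (i , j , k) →
      ⟦ u ∈ᵗ (i , j , k) ⟧ * ⟦ v ∈ᵗ (i , j , k) ⟧ ℕ.≤ δ u i * δ v j + δ u i * δ v k + δ u j * δ v k
    ⟦∈ᵗ⟧*⟦∈ᵗ⟧≤ {u} {v} u<v i j k (i<j , j<k) =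
      subst (ℕ._≤ δ u i * δ v j + δ u i * δ v k + δ u j * δ v k) (⟦∧⟧ (u ∈ᵗ (i , j , k)) _)
        (⟦⟧-≤ λ both → positions (∈ᵗ-cases u i j k (proj₁ (Equivalence.to T-∧ both)))
                                 (∈ᵗ-cases v i j k (proj₂ (Equivalence.to T-∧ both))))
      where
      open ℕ.≤-Reasoning
      positions : u ≡ i ⊎ u ≡ j ⊎ u ≡ k → v ≡ i ⊎ v ≡ j ⊎ v ≡ k →
        1 ℕ.≤ δ u i * δ v j + δ u i * δ v k + δ u j * δ v k
      positions (inj₁ u≡i) (inj₂ (inj₁ v≡j)) = begin
        1 ≡⟨ sym (δ*δ≡1 u≡i v≡j) ⟩
        δ u i * δ v j ≤⟨ ℕ.m≤m+n _ _ ⟩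
        δ u i * δ v j + δ u i * δ v k ≤⟨ ℕ.m≤m+n _ _ ⟩
        _ ∎
      positions (inj₁ u≡i) (inj₂ (inj₂ v≡k)) = begin
        1 ≡⟨ sym (δ*δ≡1 u≡i v≡k) ⟩
        δ u i * δ v k ≤⟨ ℕ.m≤n+m _ _ ⟩
        δ u i * δ v j + δ u i * δ v k ≤⟨ ℕ.m≤m+n _ _ ⟩
        _ ∎
      positions (inj₂ (inj₁ u≡j)) (inj₂ (inj₂ v≡k)) = begin
        1 ≡⟨ sym (δ*δ≡1 u≡j v≡k) ⟩
        δ u j * δ v k ≤⟨ ℕ.m≤n+m _ _ ⟩
        _ ∎
      positions (inj₁ refl) (inj₁ refl) = contradiction u<v (ℕ.<-irrefl refl)
      positions (inj₂ (inj₁ refl)) (inj₁ refl) = contradiction u<v (ℕ.<-asym i<j)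
      positions (inj₂ (inj₁ refl)) (inj₂ (inj₁ refl)) = contradiction u<v (ℕ.<-irrefl refl)
      positions (inj₂ (inj₂ refl)) (inj₁ refl) = contradiction u<v (ℕ.<-asym (ℕ.<-trans i<j j<k))
      positions (inj₂ (inj₂ refl)) (inj₂ (inj₁ refl)) = contradiction u<v (ℕ.<-asym j<k)
      positions (inj₂ (inj₂ refl)) (inj₂ (inj₂ refl)) = contradiction u<v (ℕ.<-irrefl refl)

    private
      at-most-one-order : ∀ {u v} → toℕ u ℕ.< toℕ v → ∀ x → inc u v x + inc u x v + inc x u v ℕ.≤ 1
      at-most-one-order {u} {v} _ x = ⟦⟧-exclusive
        (λ uvx uxv → ℕ.<-asym (proj₂ (order (u , v , x) uvx)) (proj₂ (order (u , x , v) uxv)))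
        (λ uvx xuv → ℕ.<-asym (proj₂ (order (u , v , x) uvx))
                              (ℕ.<-trans (proj₁ (order (x , u , v) xuv)) (proj₂ (order (x , u , v) xuv))))
        (λ uxv xuv → ℕ.<-asym (proj₁ (order (u , x , v) uxv)) (proj₁ (order (x , u , v) xuv)))
        where order = increasingᵇ⇒Increasing

      no-order-through-v : ∀ {u v} → toℕ u ℕ.< toℕ v → inc u v v + inc u v v + inc v u v ≡ 0
      no-order-through-v {u} {v} u<v =
        cong₂ _+_ (cong₂ _+_ uvv uvv) (⟦increasing⟧-≡0 (v , u , v) (ℕ.<-asym u<v ∘ proj₁))
        where uvv = ⟦increasing⟧-≡0 (u , v , v) (ℕ.<-irrefl refl ∘ proj₂)

    codegree-< : ∀ {u v} → toℕ u ℕ.< toℕ v → ∑ᵗ (λ t → ⟦ u ∈ᵗ t ⟧ * ⟦ v ∈ᵗ t ⟧) ℕ.≤ n ∸ 1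
    codegree-< {u} {v} u<v = begin
      ∑ᵗ (λ t → ⟦ u ∈ᵗ t ⟧ * ⟦ v ∈ᵗ t ⟧)
        ≤⟨ ∑ᵗ-mono-≤ (λ (i , j , k) → ⟦∈ᵗ⟧*⟦∈ᵗ⟧≤ u<v i j k) ⟩
      ∑ᵗ (λ (i , j , k) → δ u i * δ v j + δ u i * δ v k + δ u j * δ v k)
        ≡⟨ trans (∑ᵗ-distrib-+ {n} _ _) (cong₂ _+_ (∑ᵗ-distrib-+ {n} _ _) refl) ⟩
      ∑ᵗ (λ (i , j , k) → δ u i * δ v j) + ∑ᵗ (λ (i , j , k) → δ u i * δ v k) + ∑ᵗ (λ (i , j , k) → δ u j * δ v k)
        ≡⟨ cong₂ _+_ (cong₂ _+_ (∑ᵗ-at₁₂ u v) (∑ᵗ-at₁₃ u v)) (∑ᵗ-at₂₃ u v) ⟩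
      (∑[ x < n ] inc u v x) + (∑[ x < n ] inc u x v) + (∑[ x < n ] inc x u v)
        ≡⟨ sym (trans (∑-distrib-+ n _ _) (cong₂ _+_ (∑-distrib-+ n _ _) refl)) ⟩
      ∑[ x < n ] inc u v x + inc u x v + inc x u v
        ≤⟨ ∑-≤-pred n v (no-order-through-v u<v) (at-most-one-order u<v) ⟩
      n ∸ 1 ∎
      where open ℕ.≤-Reasoning

    codegree-≤ : ∀ {u v} → u ≢ v → ∑ᵗ (λ t → ⟦ u ∈ᵗ t ⟧ * ⟦ v ∈ᵗ t ⟧) ℕ.≤ n ∸ 1
    codegree-≤ {u} {v} u≢v with ℕ.<-cmp (toℕ u) (toℕ v)
    ... | tri< u<v _ _ = codegree-< u<v
    ... | tri≈ _ u≡v _ = contradiction (toℕ-injective u≡v) u≢v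
    ... | tri> _ _ v<u = ℕ.≤-trans (ℕ.≤-reflexive (∑ᵗ-cong λ t → ℕ.*-comm ⟦ u ∈ᵗ t ⟧ _)) (codegree-< v<u)

  C2-suc : ∀ n → suc n C 2 ≡ n + n C 2
  C2-suc n = trans (sym (nCk+nC[k+1]≡[n+1]C[k+1] n 1)) (cong (_+ n C 2) (nC1≡n n))

  C2*2 : ∀ n → (n C 2) * 2 ≡ n * (n ∸ 1)
  C2*2 zero = refl
  C2*2 (suc zero) = refl
  C2*2 (suc (suc n)) = begin
    (suc (suc n) C 2) * 2             ≡⟨ cong (_* 2) (C2-suc (suc n)) ⟩
    (suc n + suc n C 2) * 2           ≡⟨ ℕ.*-distribʳ-+ 2 (suc n) (suc n C 2) ⟩
    suc n * 2 + (suc n C 2) * 2       ≡⟨ cong (suc n * 2 +_) (C2*2 (suc n)) ⟩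
    suc n * 2 + suc n * n             ≡⟨ solve 1 (λ n → (con 1 :+ n) :* con 2 :+ (con 1 :+ n) :* n
                                                     := (con 2 :+ n) :* (con 1 :+ n)) refl n ⟩
    suc (suc n) * suc n               ∎
    where
    open ≡-Reasoning
    open +-*-Solver using (solve; _:*_; _:+_; _:=_; con)

  #pairs : ∀ n → ∑[ u < n ] ∑[ w < n ] ⟦ toℕ u <ᵇ toℕ w ⟧ ≡ n C 2
  #pairs zero = refl
  #pairs (suc n) = begin
    (∑[ w < n ] 1) + (∑[ u < n ] ∑[ w < n ] ⟦ toℕ u <ᵇ toℕ w ⟧)  ≡⟨ cong₂ _+_ (∑-const n) (#pairs n) ⟩
    n + n C 2                                               ≡⟨ sym (C2-suc n) ⟩
    suc n C 2                                               ∎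
    where
    open ≡-Reasoning
    ∑-const : ∀ n → ∑[ w < n ] 1 ≡ n
    ∑-const zero = refl
    ∑-const (suc n) = cong suc (∑-const n)

  -- The cleaning construction

  module Cleanup {n : ℕ} (H : 3Graph n) (light : Fin n → Fin n → Bool) where

    heavy : Triple n → Bool
    heavy (i , j , k) = not (light i j) ∧ not (light i k) ∧ not (light j k)

    lightLoss : Fin n → ℕ
    lightLoss v = ∑ᵗ λ t → ⟦ H t ∧ v ∈ᵗ t ∧ not (heavy t) ⟧

    lightMass : ℕ
    lightMass = ∑[ u < n ] ∑[ w < n ] ⟦ toℕ u <ᵇ toℕ w ⟧ * (⟦ light u w ⟧ * deg₂ H u w)

    private
      pairWeight : Triple n → Fin n → Fin n → ℕ
      pairWeight t u w = ⟦ toℕ u <ᵇ toℕ w ⟧ * (⟦ light u w ⟧ * ⟦ H t ∧ u ∈ᵗ t ∧ w ∈ᵗ t ⟧)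

      light-pair≤ : ∀ {i j} t → toℕ i ℕ.< toℕ j → T (H t) → T (light i j) → T (i ∈ᵗ t) → T (j ∈ᵗ t) →
        1 ℕ.≤ ∑[ u < n ] ∑[ w < n ] pairWeight t u w
      light-pair≤ {i} {j} t i<j h l i∈t j∈t = ℕ.≤-trans (ℕ.≤-reflexive (sym one)) (pair-term≤ (pairWeight t) i j)
        where
        one : pairWeight t i j ≡ 1
        one rewrite ⟦⟧-true (<⇒<ᵇ i<j) | ⟦⟧-true l
                  | ⟦⟧-true (Equivalence.from T-∧ (h , Equivalence.from T-∧ (i∈t , j∈t))) = refl

      nonheavy≤pairs : ∀ t → Increasing t → ⟦ H t ∧ not (heavy t) ⟧ ℕ.≤ ∑[ u < n ] ∑[ w < n ] pairWeight t u w
      nonheavy≤pairs t@(i , j , k) (i<j , j<k) = ⟦⟧-≤ (λ h∧¬heavy →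
        some-light-pair (proj₁ (Equivalence.to T-∧ h∧¬heavy)) (proj₂ (Equivalence.to T-∧ h∧¬heavy)))
        where
        some-light-pair : T (H t) → T (not (heavy t)) → 1 ℕ.≤ ∑[ u < n ] ∑[ w < n ] pairWeight t u w
        some-light-pair h ¬heavy with light i j in lij | light i k in lik | light j k in ljk
        ... | true | _ | _ = light-pair≤ t i<j h (Equivalence.from T-≡ lij) (∈ᵗ-first i j k) (∈ᵗ-second i j k)
        ... | false | true | _ =
          light-pair≤ t (ℕ.<-trans i<j j<k) h (Equivalence.from T-≡ lik) (∈ᵗ-first i j k) (∈ᵗ-third i j k)
        ... | false | false | true =
          light-pair≤ t j<k h (Equivalence.from T-≡ ljk) (∈ᵗ-second i j k) (∈ᵗ-third i j k)

    ∑-lightLoss : ∑ n lightLoss ℕ.≤ 3 * lightMass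
    ∑-lightLoss = begin
      ∑ n lightLoss
        ≡⟨ sym (∑ᵗ-comm {n} (λ v t → ⟦ H t ∧ v ∈ᵗ t ∧ not (heavy t) ⟧)) ⟩
      ∑ᵗ (λ t → ∑[ v < n ] ⟦ H t ∧ v ∈ᵗ t ∧ not (heavy t) ⟧)
        ≤⟨ ∑ᵗ-mono-≤ {n} (λ t _ → spread t) ⟩
      ∑ᵗ (λ t → 3 * ⟦ H t ∧ not (heavy t) ⟧)
        ≡⟨ ∑ᵗ-*ˡ {n} 3 _ ⟩
      3 * ∑ᵗ (λ t → ⟦ H t ∧ not (heavy t) ⟧)
        ≤⟨ ℕ.*-monoʳ-≤ 3 (∑ᵗ-mono-≤ {n} nonheavy≤pairs) ⟩
      3 * ∑ᵗ (λ t → ∑[ u < n ] ∑[ w < n ] pairWeight t u w)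
        ≡⟨ cong (3 *_) (trans (∑ᵗ-comm {n} {n} _)
             (∑-cong n λ u → trans (∑ᵗ-comm {n} {n} _) (∑-cong n λ w → collapse u w))) ⟩
      3 * lightMass ∎
      where
      open ℕ.≤-Reasoning
      spread : ∀ t → ∑[ v < n ] ⟦ H t ∧ v ∈ᵗ t ∧ not (heavy t) ⟧ ℕ.≤ 3 * ⟦ H t ∧ not (heavy t) ⟧
      spread t = begin
        ∑[ v < n ] ⟦ H t ∧ v ∈ᵗ t ∧ not (heavy t) ⟧   ≡⟨ ∑-cong n (λ v → ⟦∧∧⟧ (H t) (v ∈ᵗ t) _) ⟩
        ∑[ v < n ] ⟦ H t ∧ not (heavy t) ⟧ * ⟦ v ∈ᵗ t ⟧ ≡⟨ ∑-*ˡ n ⟦ H t ∧ not (heavy t) ⟧ _ ⟩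
        ⟦ H t ∧ not (heavy t) ⟧ * (∑[ v < n ] ⟦ v ∈ᵗ t ⟧) ≤⟨ ℕ.*-monoʳ-≤ ⟦ H t ∧ not (heavy t) ⟧ (∑-∈ᵗ≤3 t) ⟩
        ⟦ H t ∧ not (heavy t) ⟧ * 3                    ≡⟨ ℕ.*-comm ⟦ H t ∧ not (heavy t) ⟧ 3 ⟩
        3 * ⟦ H t ∧ not (heavy t) ⟧                    ∎
      collapse : ∀ u w → ∑ᵗ (λ t → pairWeight t u w) ≡ ⟦ toℕ u <ᵇ toℕ w ⟧ * (⟦ light u w ⟧ * deg₂ H u w)
      collapse u w = trans (∑ᵗ-*ˡ {n} ⟦ toℕ u <ᵇ toℕ w ⟧ _) (cong (⟦ toℕ u <ᵇ toℕ w ⟧ *_)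
        (trans (∑ᵗ-*ˡ {n} ⟦ light u w ⟧ (λ t → ⟦ H t ∧ u ∈ᵗ t ∧ w ∈ᵗ t ⟧))
          (cong (⟦ light u w ⟧ *_) (sym (count-triples n (λ t → H t ∧ u ∈ᵗ t ∧ w ∈ᵗ t))))))

    module Prune (bad : Fin n → Bool) where

      kept : Fin n → Bool
      kept v = not (bad v)

      allKept : Triple n → Bool
      allKept (i , j , k) = kept i ∧ kept j ∧ kept k

      E : 3Graph n
      E t = H t ∧ heavy t ∧ allKept t

      #bad : ℕ
      #bad = ∑[ v < n ] ⟦ bad v ⟧

      E-parts : ∀ t → T (E t) → T (H t) × T (heavy t) × T (allKept t)
      E-parts t = T-∧³ {H t} {heavy t} {allKept t}

      pruned : SubHypergraph H
      pruned = record { W = kept ; E = E ; sub = λ t _ → proj₁ ∘ E-parts t ; inW = inW }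
        where
        inW : ∀ t → Increasing t → T (E t) → ∀ v → T (v ∈ᵗ t) → T (kept v)
        inW t@(i , j , k) _ e v v∈t
          with T-∧³ {kept i} {kept j} {kept k} (proj₂ (proj₂ (E-parts t e))) | ∈ᵗ-cases v i j k v∈t
        ... | ki , _ , _ | inj₁ refl = ki
        ... | _ , kj , _ | inj₂ (inj₁ refl) = kj
        ... | _ , _ , kk | inj₂ (inj₂ refl) = kk

      missing-kept : missing kept ≡ #bad
      missing-kept = trans (length-filter (not ∘ kept) (allFin n))
        (trans (∑ˡ-allFin n _) (∑-cong n λ v → cong ⟦_⟧ (not-involutive (bad v))))

      shadow-heavy : ∀ {u w} → toℕ u ℕ.< toℕ w → InShadow E u w → T (not (light u w))
      shadow-heavy {u} {w} u<w ((i , j , k) , (i<j , j<k) , e , u∈t , w∈t)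
        with T-∧³ {not (light i j)} {not (light i k)} {not (light j k)} (proj₁ (proj₂ (E-parts (i , j , k) e)))
           | ∈ᵗ-cases u i j k u∈t | ∈ᵗ-cases w i j k w∈t
      ... | ij , _ , _ | inj₁ refl | inj₂ (inj₁ refl) = ij
      ... | _ , ik , _ | inj₁ refl | inj₂ (inj₂ refl) = ik
      ... | _ , _ , jk | inj₂ (inj₁ refl) | inj₂ (inj₂ refl) = jk
      ... | _ | inj₁ refl | inj₁ refl = contradiction u<w (ℕ.<-irrefl refl)
      ... | _ | inj₂ (inj₁ refl) | inj₂ (inj₁ refl) = contradiction u<w (ℕ.<-irrefl refl)
      ... | _ | inj₂ (inj₂ refl) | inj₂ (inj₂ refl) = contradiction u<w (ℕ.<-irrefl refl)
      ... | _ | inj₂ (inj₁ refl) | inj₁ refl = contradiction u<w (ℕ.<-asym i<j)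
      ... | _ | inj₂ (inj₂ refl) | inj₁ refl = contradiction u<w (ℕ.<-asym (ℕ.<-trans i<j j<k))
      ... | _ | inj₂ (inj₂ refl) | inj₂ (inj₁ refl) = contradiction u<w (ℕ.<-asym j<k)

      badIn : Triple n → ℕ
      badIn t = ∑[ u < n ] ⟦ bad u ⟧ * ⟦ u ∈ᵗ t ⟧

      private
        bad∈t : ∀ {x} t → T (bad x) → T (x ∈ᵗ t) → 1 ℕ.≤ badIn t
        bad∈t {x} t bx x∈t =
          ℕ.≤-trans (ℕ.≤-reflexive (sym (cong₂ _*_ (⟦⟧-true bx) (⟦⟧-true x∈t)))) (term≤∑ n _ x)

        ⟦¬allKept⟧≤badIn : ∀ t → ⟦ not (allKept t) ⟧ ℕ.≤ badIn t
        ⟦¬allKept⟧≤badIn t@(i , j , k) = ⟦⟧-≤ some-bad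
          where
          some-bad : T (not (allKept t)) → 1 ℕ.≤ badIn t
          some-bad ¬all with bad i in bi | bad j in bj | bad k in bk
          ... | true | _ | _ = bad∈t t (Equivalence.from T-≡ bi) (∈ᵗ-first i j k)
          ... | false | true | _ = bad∈t t (Equivalence.from T-≡ bj) (∈ᵗ-second i j k)
          ... | false | false | true = bad∈t t (Equivalence.from T-≡ bk) (∈ᵗ-third i j k)

        edges-at≤ : ∀ v t → ⟦ H t ∧ v ∈ᵗ t ⟧ ℕ.≤
          ⟦ E t ∧ v ∈ᵗ t ⟧ + ⟦ H t ∧ v ∈ᵗ t ∧ not (heavy t) ⟧ + ⟦ v ∈ᵗ t ⟧ * badIn t
        edges-at≤ v t = ℕ.≤-trans (⟦⟧-split (H t) (v ∈ᵗ t) (heavy t) (allKept t))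
          (ℕ.+-monoʳ-≤ _ (ℕ.*-monoʳ-≤ ⟦ v ∈ᵗ t ⟧ (⟦¬allKept⟧≤badIn t)))

      ∑-badIn≤ : ∀ v → T (kept v) → ∑ᵗ (λ t → ⟦ v ∈ᵗ t ⟧ * badIn t) ℕ.≤ #bad * (n ∸ 1)
      ∑-badIn≤ v kv = begin
        ∑ᵗ (λ t → ⟦ v ∈ᵗ t ⟧ * badIn t)
          ≡⟨ ∑ᵗ-cong {n} (λ t → trans (sym (∑-*ˡ n ⟦ v ∈ᵗ t ⟧ _))
               (∑-cong n λ u → *-rotate ⟦ v ∈ᵗ t ⟧ ⟦ bad u ⟧ ⟦ u ∈ᵗ t ⟧)) ⟩
        ∑ᵗ (λ t → ∑[ u < n ] ⟦ bad u ⟧ * (⟦ u ∈ᵗ t ⟧ * ⟦ v ∈ᵗ t ⟧))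
          ≡⟨ ∑ᵗ-comm {n} {n} _ ⟩
        ∑[ u < n ] ∑ᵗ (λ t → ⟦ bad u ⟧ * (⟦ u ∈ᵗ t ⟧ * ⟦ v ∈ᵗ t ⟧))
          ≡⟨ ∑-cong n (λ u → ∑ᵗ-*ˡ {n} ⟦ bad u ⟧ _) ⟩
        ∑[ u < n ] ⟦ bad u ⟧ * ∑ᵗ (λ t → ⟦ u ∈ᵗ t ⟧ * ⟦ v ∈ᵗ t ⟧)
          ≤⟨ ∑-mono-≤ n bad-codegree ⟩
        ∑[ u < n ] ⟦ bad u ⟧ * (n ∸ 1)
          ≡⟨ trans (∑-cong n λ u → ℕ.*-comm ⟦ bad u ⟧ (n ∸ 1)) (trans (∑-*ˡ n (n ∸ 1) _) (ℕ.*-comm (n ∸ 1) #bad)) ⟩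
        #bad * (n ∸ 1) ∎
        where
        open ℕ.≤-Reasoning
        bad-codegree : ∀ u → ⟦ bad u ⟧ * ∑ᵗ (λ t → ⟦ u ∈ᵗ t ⟧ * ⟦ v ∈ᵗ t ⟧) ℕ.≤ ⟦ bad u ⟧ * (n ∸ 1)
        bad-codegree u with bad u in bu
        ... | false = z≤n
        ... | true = ℕ.*-monoʳ-≤ 1 (codegree-≤ u≢v)
          where
          u≢v : u ≢ v
          u≢v refl = subst (T ∘ not) bu kv

      deg-loss : ∀ v → T (kept v) → deg H v ℕ.≤ deg E v + lightLoss v + #bad * (n ∸ 1)
      deg-loss v kv = begin
        deg H v
          ≡⟨ count-triples n (λ t → H t ∧ v ∈ᵗ t) ⟩
        ∑ᵗ (λ t → ⟦ H t ∧ v ∈ᵗ t ⟧)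
          ≤⟨ ∑ᵗ-mono-≤ {n} (λ t _ → edges-at≤ v t) ⟩
        ∑ᵗ (λ t → ⟦ E t ∧ v ∈ᵗ t ⟧ + ⟦ H t ∧ v ∈ᵗ t ∧ not (heavy t) ⟧ + ⟦ v ∈ᵗ t ⟧ * badIn t)
          ≡⟨ trans (∑ᵗ-distrib-+ {n} _ _) (cong₂ _+_ (∑ᵗ-distrib-+ {n} _ _) refl) ⟩
        ∑ᵗ (λ t → ⟦ E t ∧ v ∈ᵗ t ⟧) + lightLoss v + ∑ᵗ (λ t → ⟦ v ∈ᵗ t ⟧ * badIn t)
          ≤⟨ ℕ.+-mono-≤ (ℕ.≤-reflexive (cong (_+ lightLoss v) (sym (count-triples n (λ t → E t ∧ v ∈ᵗ t)))))
                        (∑-badIn≤ v kv) ⟩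
        deg E v + lightLoss v + #bad * (n ∸ 1) ∎
        where open ℕ.≤-Reasoning

  -- Passing to the rationals

  private
    +m*1≡+m : ∀ m → ℤ.+_ m ℤ.* 1ℤ ≡ ℤ.+_ m
    +m*1≡+m m = ℤ.*-identityʳ (ℤ.+_ m)

  -- ℕ→ℚ in normal form, opaque so that unification never runs the gcd normalisation hidden in ℕ→ℚ.
  opaque
    fromℕ : ℕ → ℚ
    fromℕ m = mkℚ (ℤ.+_ m) 0 (Coprime.sym (Coprime.1-coprimeTo m))

    fromℕ≡ℕ→ℚ : ∀ m → fromℕ m ≡ ℕ→ℚ m
    fromℕ≡ℕ→ℚ m = sym (ℚ.normalize-coprime (Coprime.sym (Coprime.1-coprimeTo m)))

    fromℕ-0 : fromℕ 0 ≡ 0ℚ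
    fromℕ-0 = refl

    fromℕ-1 : fromℕ 1 ≡ 1ℚ
    fromℕ-1 = refl

    fromℕ-homo-+ : ∀ a b → fromℕ (a + b) ≡ fromℕ a ℚ.+ fromℕ b
    fromℕ-homo-+ a b =
      ℚ.toℚᵘ-injective (ℚᵘ.≃-trans (ℚᵘ.*≡* cross) (ℚᵘ.≃-sym (ℚ.toℚᵘ-homo-+ (fromℕ a) (fromℕ b))))
      where
      cross : ℤ.+_ (a + b) ℤ.* (1ℤ ℤ.* 1ℤ) ≡ (ℤ.+_ a ℤ.* 1ℤ ℤ.+ ℤ.+_ b ℤ.* 1ℤ) ℤ.* 1ℤ
      cross rewrite +m*1≡+m a | +m*1≡+m b | ℤ.*-identityʳ (ℤ.+_ a ℤ.+ ℤ.+_ b) = ℤ.pos-+ a b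

    fromℕ-homo-* : ∀ a b → fromℕ (a * b) ≡ fromℕ a ℚ.* fromℕ b
    fromℕ-homo-* a b =
      ℚ.toℚᵘ-injective (ℚᵘ.≃-trans (ℚᵘ.*≡* cross) (ℚᵘ.≃-sym (ℚ.toℚᵘ-homo-* (fromℕ a) (fromℕ b))))
      where
      cross : ℤ.+_ (a * b) ℤ.* (1ℤ ℤ.* 1ℤ) ≡ (ℤ.+_ a ℤ.* ℤ.+_ b) ℤ.* 1ℤ
      cross rewrite ℤ.*-identityʳ (ℤ.+_ a ℤ.* ℤ.+_ b) | +m*1≡+m (a * b) = ℤ.pos-* a b

    fromℕ-mono-≤ : ∀ {a b} → a ℕ.≤ b → fromℕ a ℚ.≤ fromℕ b
    fromℕ-mono-≤ {a} {b} a≤b = ℚ.*≤* (subst₂ ℤ._≤_ (sym (+m*1≡+m a)) (sym (+m*1≡+m b)) (ℤ.+≤+ a≤b))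

    fromℕ-mono-< : ∀ {a b} → a ℕ.< b → fromℕ a ℚ.< fromℕ b
    fromℕ-mono-< {a} {b} a<b = ℚ.*<* (subst₂ ℤ._<_ (sym (+m*1≡+m a)) (sym (+m*1≡+m b)) (ℤ.+<+ a<b))

  fromℕ-0* : ∀ c → fromℕ 0 ℚ.* c ≡ fromℕ 0
  fromℕ-0* c = trans (cong (ℚ._* c) fromℕ-0) (trans (ℚ.*-zeroˡ c) (sym fromℕ-0))

  fromℕ-1* : ∀ c → fromℕ 1 ℚ.* c ≡ c
  fromℕ-1* c = trans (cong (ℚ._* c) fromℕ-1) (ℚ.*-identityˡ c)

  fromℕ-cancel-< : ∀ {a b} → fromℕ a ℚ.< fromℕ b → a ℕ.< b
  fromℕ-cancel-< qa<qb = ℕ.≰⇒> λ b≤a → ℚ.<-irrefl refl (ℚ.<-≤-trans qa<qb (fromℕ-mono-≤ b≤a))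

  fromℕ-nonNeg : ∀ a → 0ℚ ℚ.≤ fromℕ a
  fromℕ-nonNeg a = subst (ℚ._≤ fromℕ a) fromℕ-0 (fromℕ-mono-≤ z≤n)

  ∑-≤-∑* : ∀ n {f g : Fin n → ℕ} c → (∀ i → fromℕ (f i) ℚ.≤ fromℕ (g i) ℚ.* c) →
    fromℕ (∑ n f) ℚ.≤ fromℕ (∑ n g) ℚ.* c
  ∑-≤-∑* zero c _ = ℚ.≤-reflexive (sym (fromℕ-0* c))
  ∑-≤-∑* (suc n) {f} {g} c f≤gc = begin
    fromℕ (f zero + ∑ n (f ∘ suc))                      ≡⟨ fromℕ-homo-+ (f zero) _ ⟩
    fromℕ (f zero) ℚ.+ fromℕ (∑ n (f ∘ suc))              ≤⟨ ℚ.+-mono-≤ (f≤gc zero) (∑-≤-∑* n c (f≤gc ∘ suc)) ⟩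
    fromℕ (g zero) ℚ.* c ℚ.+ fromℕ (∑ n (g ∘ suc)) ℚ.* c  ≡⟨ sym (ℚ.*-distribʳ-+ c (fromℕ (g zero)) _) ⟩
    (fromℕ (g zero) ℚ.+ fromℕ (∑ n (g ∘ suc))) ℚ.* c      ≡⟨ cong (ℚ._* c) (sym (fromℕ-homo-+ (g zero) _)) ⟩
    fromℕ (g zero + ∑ n (g ∘ suc)) ℚ.* c                ∎
    where open ℚ.≤-Reasoning

  ∑*-≤-∑ : ∀ n {f g : Fin n → ℕ} c → (∀ i → fromℕ (f i) ℚ.* c ℚ.≤ fromℕ (g i)) →
    fromℕ (∑ n f) ℚ.* c ℚ.≤ fromℕ (∑ n g)
  ∑*-≤-∑ zero c _ = ℚ.≤-reflexive (fromℕ-0* c)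
  ∑*-≤-∑ (suc n) {f} {g} c fc≤g = begin
    fromℕ (f zero + ∑ n (f ∘ suc)) ℚ.* c                ≡⟨ cong (ℚ._* c) (fromℕ-homo-+ (f zero) _) ⟩
    (fromℕ (f zero) ℚ.+ fromℕ (∑ n (f ∘ suc))) ℚ.* c      ≡⟨ ℚ.*-distribʳ-+ c (fromℕ (f zero)) _ ⟩
    fromℕ (f zero) ℚ.* c ℚ.+ fromℕ (∑ n (f ∘ suc)) ℚ.* c  ≤⟨ ℚ.+-mono-≤ (fc≤g zero) (∑*-≤-∑ n c (fc≤g ∘ suc)) ⟩
    fromℕ (g zero) ℚ.+ fromℕ (∑ n (g ∘ suc))              ≡⟨ sym (fromℕ-homo-+ (g zero) _) ⟩
    fromℕ (g zero + ∑ n (g ∘ suc))                      ∎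
    where open ℚ.≤-Reasoning

  private
    ℚ*-nonNeg : ∀ {p q} → 0ℚ ℚ.≤ p → 0ℚ ℚ.≤ q → 0ℚ ℚ.≤ p ℚ.* q
    ℚ*-nonNeg {p} {q} p≥0 q≥0 =
      ℚ.nonNegative⁻¹ _ {{ℚ.nonNeg*nonNeg⇒nonNeg p {{ℚ.nonNegative p≥0}} q {{ℚ.nonNegative q≥0}}}}

  ⟦⟧*-≤ : ∀ b m {c} → (T b → fromℕ m ℚ.≤ c) → fromℕ (⟦ b ⟧ * m) ℚ.≤ fromℕ ⟦ b ⟧ ℚ.* c
  ⟦⟧*-≤ false m {c} _ = ℚ.≤-reflexive (sym (fromℕ-0* c))
  ⟦⟧*-≤ true m {c} m≤c = begin
    fromℕ (m + 0) ≡⟨ cong fromℕ (ℕ.+-identityʳ m) ⟩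
    fromℕ m       ≤⟨ m≤c _ ⟩
    c             ≡⟨ sym (fromℕ-1* c) ⟩
    fromℕ 1 ℚ.* c ∎
    where open ℚ.≤-Reasoning

  ⟦⟧*-≥ : ∀ b m {c} → (T b → c ℚ.≤ fromℕ m) → fromℕ ⟦ b ⟧ ℚ.* c ℚ.≤ fromℕ (⟦ b ⟧ * m)
  ⟦⟧*-≥ false m {c} _ = ℚ.≤-reflexive (fromℕ-0* c)
  ⟦⟧*-≥ true m {c} c≤m = begin
    fromℕ 1 ℚ.* c ≡⟨ fromℕ-1* c ⟩
    c             ≤⟨ c≤m _ ⟩
    fromℕ m       ≡⟨ cong fromℕ (sym (ℕ.+-identityʳ m)) ⟩
    fromℕ (m + 0) ∎
    where open ℚ.≤-Reasoning

  module Construction (ε : ℚ) (ε>0 : 0ℚ ℚ.< ε) {n : ℕ} (H : 3Graph n) where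

    θ : ℚ
    θ = ε ℚ.* ε ℚ.* fromℕ n

    light : Fin n → Fin n → Bool
    light u w = ⌊ fromℕ (deg₂ H u w) ℚ.≤? θ ⌋

    open Cleanup H light public

    C₂ : ℚ
    C₂ = fromℕ (n C 2)

    bad : Fin n → Bool
    bad v = ⌊ ε ℚ.* C₂ ℚ.<? fromℕ (lightLoss v) ⌋

    open Prune bad public

    light-deg₂ : ∀ u w → T (light u w) → fromℕ (deg₂ H u w) ℚ.≤ θ
    light-deg₂ u w = toWitness {a? = fromℕ (deg₂ H u w) ℚ.≤? θ}

    bad-cost : ∀ v → T (bad v) → ε ℚ.* C₂ ℚ.< fromℕ (lightLoss v)
    bad-cost v = toWitness {a? = ε ℚ.* C₂ ℚ.<? fromℕ (lightLoss v)}

    private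
      ε≥0 : 0ℚ ℚ.≤ ε
      ε≥0 = ℚ.<⇒≤ ε>0

      θ≥0 : 0ℚ ℚ.≤ θ
      θ≥0 = ℚ*-nonNeg (ℚ*-nonNeg ε≥0 ε≥0) (fromℕ-nonNeg n)

    lightMass≤ : fromℕ lightMass ℚ.≤ C₂ ℚ.* θ
    lightMass≤ = begin
      fromℕ lightMass
        ≤⟨ ∑-≤-∑* n θ (λ u → ∑-≤-∑* n θ (λ w → ⟦⟧*-≤ (toℕ u <ᵇ toℕ w) _ (λ _ → light-pair≤θ u w))) ⟩
      fromℕ (∑[ u < n ] ∑[ w < n ] ⟦ toℕ u <ᵇ toℕ w ⟧) ℚ.* θ
        ≡⟨ cong (λ m → fromℕ m ℚ.* θ) (#pairs n) ⟩
      C₂ ℚ.* θ ∎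
      where
      open ℚ.≤-Reasoning
      light-pair≤θ : ∀ u w → fromℕ (⟦ light u w ⟧ * deg₂ H u w) ℚ.≤ θ
      light-pair≤θ u w = ℚ.≤-trans (⟦⟧*-≤ (light u w) (deg₂ H u w) (light-deg₂ u w))
        (ℚ.≤-trans (ℚ.*-monoʳ-≤-nonNeg θ {{ℚ.nonNegative θ≥0}} (fromℕ-mono-≤ {⟦ light u w ⟧} {1} (⟦⟧≤1 (light u w))))
          (ℚ.≤-reflexive (fromℕ-1* θ)))

    lightLoss-total : fromℕ (∑ n lightLoss) ℚ.≤ fromℕ 3 ℚ.* (C₂ ℚ.* θ)
    lightLoss-total = begin
      fromℕ (∑ n lightLoss)     ≤⟨ fromℕ-mono-≤ ∑-lightLoss ⟩
      fromℕ (3 * lightMass)     ≡⟨ fromℕ-homo-* 3 lightMass ⟩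
      fromℕ 3 ℚ.* fromℕ lightMass ≤⟨ ℚ.*-monoˡ-≤-nonNeg (fromℕ 3) {{ℚ.nonNegative (fromℕ-nonNeg 3)}} lightMass≤ ⟩
      fromℕ 3 ℚ.* (C₂ ℚ.* θ)    ∎
      where open ℚ.≤-Reasoning

    kept-lightLoss : ∀ v → T (kept v) → fromℕ (lightLoss v) ℚ.≤ ε ℚ.* C₂
    kept-lightLoss v kv = ℚ.≮⇒≥ (toWitnessFalse {a? = ε ℚ.* C₂ ℚ.<? fromℕ (lightLoss v)} kv)

    private
      εC₂≥0 : 0ℚ ℚ.≤ ε ℚ.* C₂
      εC₂≥0 = ℚ*-nonNeg ε≥0 (fromℕ-nonNeg (n C 2))

      bad⇒lossy : ∀ v → ⟦ bad v ⟧ ℕ.≤ lightLoss v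
      bad⇒lossy v = ⟦⟧-≤ λ bv →
        fromℕ-cancel-< (ℚ.≤-<-trans (ℚ.≤-trans (ℚ.≤-reflexive fromℕ-0) εC₂≥0) (bad-cost v bv))

    -- Markov's inequality; if n < 2 there are no pairs, so nothing is lost and no vertex is bad.
    #bad≤ : fromℕ #bad ℚ.≤ fromℕ 3 ℚ.* ε ℚ.* fromℕ n
    #bad≤ = by-#pairs (n C 2) refl
      where
      open ℚ.≤-Reasoning
      by-#pairs : ∀ m → n C 2 ≡ m → fromℕ #bad ℚ.≤ fromℕ 3 ℚ.* ε ℚ.* fromℕ n
      by-#pairs zero C≡0 = begin
        fromℕ #bad                  ≤⟨ fromℕ-mono-≤ (∑-mono-≤ n bad⇒lossy) ⟩
        fromℕ (∑ n lightLoss)       ≤⟨ lightLoss-total ⟩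
        fromℕ 3 ℚ.* (C₂ ℚ.* θ)      ≡⟨ cong (λ c → fromℕ 3 ℚ.* (fromℕ c ℚ.* θ)) C≡0 ⟩
        fromℕ 3 ℚ.* (fromℕ 0 ℚ.* θ) ≡⟨ trans (cong (fromℕ 3 ℚ.*_) (trans (fromℕ-0* θ) fromℕ-0)) (ℚ.*-zeroʳ (fromℕ 3)) ⟩
        0ℚ                          ≤⟨ ℚ*-nonNeg (ℚ*-nonNeg (fromℕ-nonNeg 3) ε≥0) (fromℕ-nonNeg n) ⟩
        fromℕ 3 ℚ.* ε ℚ.* fromℕ n   ∎
      by-#pairs (suc c) C≡1+c = ℚ.*-cancelʳ-≤-pos (ε ℚ.* C₂) {{εC₂>0}} (begin
        fromℕ #bad ℚ.* (ε ℚ.* C₂)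
          ≤⟨ ∑*-≤-∑ n (ε ℚ.* C₂) (λ v → ⟦⟧*-≥ (bad v) (lightLoss v) (ℚ.<⇒≤ ∘ bad-cost v)) ⟩
        fromℕ (∑[ v < n ] ⟦ bad v ⟧ * lightLoss v)
          ≤⟨ fromℕ-mono-≤ (∑-mono-≤ n λ v → ⟦⟧*≤ (bad v) (lightLoss v)) ⟩
        fromℕ (∑ n lightLoss)
          ≤⟨ lightLoss-total ⟩
        fromℕ 3 ℚ.* (C₂ ℚ.* (ε ℚ.* ε ℚ.* fromℕ n))
          ≡⟨ solve 4 (λ a e c m → a :* (c :* (e :* e :* m)) := a :* e :* m :* (e :* c))
               refl (fromℕ 3) ε C₂ (fromℕ n) ⟩
        fromℕ 3 ℚ.* ε ℚ.* fromℕ n ℚ.* (ε ℚ.* C₂) ∎)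
        where
        open ℚ-Solver using (solve; _:*_; _:=_)
        C₂>0 : 0ℚ ℚ.< C₂
        C₂>0 = subst₂ ℚ._<_ fromℕ-0 (cong fromℕ (sym C≡1+c)) (fromℕ-mono-< (s≤s z≤n))
        εC₂>0 : ℚ.Positive (ε ℚ.* C₂)
        εC₂>0 = ℚ.pos*pos⇒pos ε {{ℚ.positive ε>0}} C₂ {{ℚ.positive C₂>0}}

    kept-deg≥ : ∀ v → T (kept v) → fromℕ (deg H v) ℚ.- fromℕ 7 ℚ.* ε ℚ.* C₂ ℚ.≤ fromℕ (deg E v)
    kept-deg≥ v kv = begin
      fromℕ (deg H v) ℚ.- fromℕ 7 ℚ.* ε ℚ.* C₂
        ≤⟨ ℚ.+-monoˡ-≤ (ℚ.- (fromℕ 7 ℚ.* ε ℚ.* C₂)) degH≤ ⟩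
      d ℚ.+ ε ℚ.* C₂ ℚ.+ fromℕ 3 ℚ.* ε ℚ.* (C₂ ℚ.* fromℕ 2) ℚ.- fromℕ 7 ℚ.* ε ℚ.* C₂
        ≡⟨ cong (λ s → d ℚ.+ ε ℚ.* C₂ ℚ.+ fromℕ 3 ℚ.* ε ℚ.* (C₂ ℚ.* fromℕ 2) ℚ.- s ℚ.* ε ℚ.* C₂) seven ⟩
      d ℚ.+ ε ℚ.* C₂ ℚ.+ fromℕ 3 ℚ.* ε ℚ.* (C₂ ℚ.* fromℕ 2) ℚ.- (1ℚ ℚ.+ fromℕ 3 ℚ.* fromℕ 2) ℚ.* ε ℚ.* C₂
        ≡⟨ solve 5 (λ d e c a b → d :+ e :* c :+ a :* e :* (c :* b) :- (con 1ℚ :+ a :* b) :* e :* c := d)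
             refl d ε C₂ (fromℕ 3) (fromℕ 2) ⟩
      d ∎
      where
      open ℚ.≤-Reasoning
      open ℚ-Solver using (solve; _:+_; _:-_; _:*_; _:=_; con)
      d : ℚ
      d = fromℕ (deg E v)
      seven : fromℕ 7 ≡ 1ℚ ℚ.+ fromℕ 3 ℚ.* fromℕ 2
      seven = trans (fromℕ-homo-+ 1 6) (cong₂ ℚ._+_ fromℕ-1 (fromℕ-homo-* 3 2))
      n*[n∸1]≡C₂*2 : fromℕ n ℚ.* fromℕ (n ∸ 1) ≡ C₂ ℚ.* fromℕ 2
      n*[n∸1]≡C₂*2 = trans (sym (fromℕ-homo-* n (n ∸ 1))) (trans (cong fromℕ (sym (C2*2 n))) (fromℕ-homo-* (n C 2) 2))
      degH≤ : fromℕ (deg H v) ℚ.≤ d ℚ.+ ε ℚ.* C₂ ℚ.+ fromℕ 3 ℚ.* ε ℚ.* (C₂ ℚ.* fromℕ 2)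
      degH≤ = begin
        fromℕ (deg H v)
          ≤⟨ fromℕ-mono-≤ (deg-loss v kv) ⟩
        fromℕ (deg E v + lightLoss v + #bad * (n ∸ 1))
          ≡⟨ trans (fromℕ-homo-+ (deg E v + lightLoss v) _)
               (cong₂ ℚ._+_ (fromℕ-homo-+ (deg E v) (lightLoss v)) (fromℕ-homo-* #bad (n ∸ 1))) ⟩
        d ℚ.+ fromℕ (lightLoss v) ℚ.+ fromℕ #bad ℚ.* fromℕ (n ∸ 1)
          ≤⟨ ℚ.+-mono-≤ (ℚ.+-monoʳ-≤ d (kept-lightLoss v kv))
               (ℚ.*-monoʳ-≤-nonNeg (fromℕ (n ∸ 1)) {{ℚ.nonNegative (fromℕ-nonNeg (n ∸ 1))}} #bad≤) ⟩
        d ℚ.+ ε ℚ.* C₂ ℚ.+ fromℕ 3 ℚ.* ε ℚ.* fromℕ n ℚ.* fromℕ (n ∸ 1)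
          ≡⟨ cong (d ℚ.+ ε ℚ.* C₂ ℚ.+_) (trans (ℚ.*-assoc (fromℕ 3 ℚ.* ε) (fromℕ n) (fromℕ (n ∸ 1)))
               (cong (fromℕ 3 ℚ.* ε ℚ.*_) n*[n∸1]≡C₂*2)) ⟩
        d ℚ.+ ε ℚ.* C₂ ℚ.+ fromℕ 3 ℚ.* ε ℚ.* (C₂ ℚ.* fromℕ 2) ∎

    heavy-pair : ∀ u w → T (not (light u w)) → θ ℚ.< fromℕ (deg₂ H u w)
    heavy-pair u w ¬light = ℚ.≰⇒> (toWitnessFalse {a? = fromℕ (deg₂ H u w) ℚ.≤? θ} ¬light)

    few-removed : ℕ→ℚ (missing kept) ℚ.≤ ℕ→ℚ 3 ℚ.* ε ℚ.* ℕ→ℚ n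
    few-removed = subst₂ ℚ._≤_ (trans (cong fromℕ (sym missing-kept)) (fromℕ≡ℕ→ℚ _))
      (cong₂ (λ a b → a ℚ.* ε ℚ.* b) (fromℕ≡ℕ→ℚ 3) (fromℕ≡ℕ→ℚ n)) #bad≤

    degrees-kept : ∀ v → T (kept v) →
      ℕ→ℚ (deg H v) ℚ.- ℕ→ℚ 7 ℚ.* ε ℚ.* ℕ→ℚ (n C 2) ℚ.≤ ℕ→ℚ (deg E v)
    degrees-kept v kv = subst₂ ℚ._≤_
      (cong₂ ℚ._-_ (fromℕ≡ℕ→ℚ (deg H v)) (cong₂ (λ a b → a ℚ.* ε ℚ.* b) (fromℕ≡ℕ→ℚ 7) (fromℕ≡ℕ→ℚ (n C 2))))
      (fromℕ≡ℕ→ℚ (deg E v)) (kept-deg≥ v kv)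

    codegrees-large : ∀ u w → toℕ u ℕ.< toℕ w → InShadow E u w → ε ℚ.* ε ℚ.* ℕ→ℚ n ℚ.< ℕ→ℚ (deg₂ H u w)
    codegrees-large u w u<w uw∈∂E = subst₂ ℚ._<_ (cong (ε ℚ.* ε ℚ.*_) (fromℕ≡ℕ→ℚ n)) (fromℕ≡ℕ→ℚ (deg₂ H u w))
      (heavy-pair u w (shadow-heavy u<w uw∈∂E))

open Cleaning using (module Construction)

open import Data.Nat using (ℕ)
open import Data.Nat.Combinatorics using (_C_)
open import Data.Fin using (Fin; toℕ)
open import Data.Bool using (T)
open import Data.Product using (Σ; _×_; _,_)
open import Data.Rational using (ℚ; 0ℚ; _<_; _≤_; _*_; _-_)
open import Data.Nat as ℕ using ()

lemma3p3 : (ε : ℚ) → 0ℚ < ε → (n : ℕ) → (H : 3Graph n) →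
    Σ (SubHypergraph H) λ Hε →
      (ℕ→ℚ (missing (SubHypergraph.W Hε)) ≤ ℕ→ℚ 3 * ε * ℕ→ℚ n)
      × (∀ (v : Fin n) → T (SubHypergraph.W Hε v) →
           ℕ→ℚ (deg H v) - ℕ→ℚ 7 * ε * ℕ→ℚ (n C 2) ≤ ℕ→ℚ (deg (SubHypergraph.E Hε) v))
      × (∀ (u w : Fin n) → toℕ u ℕ.< toℕ w → InShadow (SubHypergraph.E Hε) u w →
           ε * ε * ℕ→ℚ n < ℕ→ℚ (deg₂ H u w))
lemma3p3 ε ε>0 n H = pruned , few-removed , degrees-kept , codegrees-large
  where open Construction ε ε>0 H
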